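{- Let $n\ge 3$. For integers $a\ne b$ in $\{1,\dots,n\}$ let $s(a,b)$ denote the $n$-tuple obtained from the standard die $(1,2,\dots,n)$ by replacing the entry $a$ by $a+1$ and the entry $b$ by $b-1$. Suppose $s(a,b)$ and $s(c,d)$ are proper $n$-sided dice and $s(a,b)>s(c,d)$. Then there are integers $x,y,z$ such that one of the following holds: (1) $s(a,b)=s(x,y)$ and $s(c,d)=s(y,z)$; (2) $s(a,b)=s(x,y)$ and $s(c,d)=s(z,x+2)$; (3) $s(a,b)=s(x+1,y)$ and $s(c,d)=s(x,z)$; (4) $s(a,b)=s(x,y+1)$ and $s(c,d)=s(z,y)$. Equivalently, $b=c$, or $d=a+2$, or $a=c+1$, or $b=d+1$.
   Context: An $n$-sided die is an $n$-tuple $(a_1,\dots,a_n)$ of integers with $a_1\le a_2\le\dots\le a_n$. It is proper if every $a_i\in\{1,\dots,n\}$ and $a_1+\dots+a_n=n(n+1)/2$. For dice $A=(a_1,\dots,a_n)$ and $B=(b_1,\dots,b_n)$, we write $A>B$ ($A$ beats $B$) if $\#\{(i,j): a_i>b_j\} > \#\{(i,j): b_j>a_i\}$; if the two counts are equal, $A$ and $B$ tie. Dice of the form $s(a,b)$ that are proper are called one-step (1-step) dice. -}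

module Defs where

open import Data.Nat as ℕ using (ℕ; suc)
open import Data.Nat.DivMod using (_/_)
open import Data.Integer using (ℤ; +_; _+_; _-_; _≤_; _<_; _<?_; _≟_)
open import Data.Fin using (Fin; toℕ)
import Data.Fin as F
open import Data.Vec using (Vec; lookup; tabulate; foldr)
open import Data.Bool using (if_then_else_)
open import Relation.Nullary using (does)
open import Data.Product using (_×_)
open import Relation.Binary.PropositionalEquality using (_≡_)

-- An n-sided "tuple": entries indexed by positions 0..n-1 (position i holds a_{i+1}).
Tuple : ℕ → Set
Tuple n = Vec ℤ n

δ : ℤ → ℤ → ℤ
δ x y = if does (x ≟ y) then + 1 else + 0

s : (n : ℕ) → ℤ → ℤ → Tuple n
s n a b = tabulate (λ (i : Fin n) → let v = + suc (toℕ i) in (v + δ v a) - δ v b)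

sumT : ∀ {n} → Tuple n → ℤ
sumT = foldr _ _+_ (+ 0)

IsDie : ∀ {n} → Tuple n → Set
IsDie {n} A = ∀ (i j : Fin n) → i F.≤ j → lookup A i ≤ lookup A j

Proper : ∀ {n} → Tuple n → Set
Proper {n} A = IsDie A
             × (∀ (i : Fin n) → (+ 1 ≤ lookup A i) × (lookup A i ≤ + n))
             × (sumT A ≡ + (n ℕ.* suc n / 2))

wins : ∀ {n m} → Tuple n → Tuple m → ℕ
wins A B = foldr _ (λ x acc → foldr _ (λ y acc' → (if does (y <? x) then 1 else 0) ℕ.+ acc') acc B) 0 A

_beats_ : ∀ {n} → Tuple n → Tuple n → Set
A beats B = wins B A ℕ.< wins A B

module Submission where

-- Write the advantage of a die A over B as
--   adv(A,B) = #{A-entry > B-entry} - #{B-entry > A-entry} = Σ_v Σ_w sgn(A_v - B_w).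
-- Against the standard die, a face m has row sum Σ_w sgn(m - w) = 2m - (n+1), and these
-- row sums add up to 0.  Moving one face up by 1 and another down by 1 (the passage from
-- the standard die to s(c,d)) perturbs the row sum of m by an explicit "bump", a signed
-- count of coincidences of m with c, c+1, d-1, d; the same perturbation argument applied
-- to the rows of s(a,b) then yields the exact advantage formula
--   adv(s(a,b), s(c,d)) = gains - losses,
--   gains  = [a = c+1] + [a+1 = d-1] + [b = c] + [b-1 = d],
--   losses = [a+1 = c] + [a = d] + [b-1 = c+1] + [b = d-1].

open import Defs
open import Data.Nat using (ℕ)
open import Data.Integer using (ℤ; +_; _+_; _≤_)
open import Data.Product using (_×_; ∃-syntax; _,_; proj₁; proj₂)
open import Data.Sum using (_⊎_; inj₁; inj₂)
open import Relation.Binary.PropositionalEquality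
  using (_≡_; _≢_; refl; sym; trans; cong; cong₂; subst; module ≡-Reasoning)

import Data.Nat as ℕ
import Data.Nat.Properties as ℕP
open import Data.Integer using (-_; _-_; _*_; _<_; _<?_; _≟_; +≤+; +<+)
import Data.Integer.Properties as ℤP
open import Data.Integer.Tactic.RingSolver using (solve-∀)
open import Algebra.Properties.CommutativeSemigroup ℤP.+-commutativeSemigroup using (interchange)
open import Data.Fin using (toℕ; fromℕ<)
open import Data.Fin.Properties using (toℕ-fromℕ<)
open import Data.Vec using (Vec; []; _∷_; tabulate; lookup; foldr)
open import Data.Vec.Properties using (lookup∘tabulate)
open import Data.Bool using (Bool; if_then_else_; true; false)
open import Relation.Nullary using (¬_; Dec; does; yes; no)
open import Relation.Nullary.Decidable using (dec-true; dec-false)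
open import Relation.Binary using (Tri; tri<; tri≈; tri>)
open import Data.Empty using (⊥-elim)

open ≡-Reasoning

Face : ℕ → ℤ → Set
Face n v = + 1 ≤ v × v ≤ + n

no-face-zero : ∀ {v} → ¬ Face 0 v
no-face-zero (1≤v , v≤0) with ℤP.≤-trans 1≤v v≤0
... | +≤+ ()

top-face : ∀ n → Face (ℕ.suc n) (+ ℕ.suc n)
top-face n = +≤+ (ℕ.s≤s ℕ.z≤n) , ℤP.≤-refl

face-weaken : ∀ {n v} → Face n v → Face (ℕ.suc n) v
face-weaken (1≤v , v≤n) = 1≤v , ℤP.≤-trans v≤n (+≤+ (ℕP.n≤1+n _))

face-<-top : ∀ {n v} → Face n v → v < + ℕ.suc n
face-<-top {n} (_ , v≤n) = ℤP.≤-<-trans v≤n (+<+ (ℕP.n<1+n n))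

face-below-top : ∀ {n v} → Face (ℕ.suc n) v → v ≢ + ℕ.suc n → Face n v
face-below-top (1≤v , v≤1+n) v≢1+n = 1≤v , ℤP.i<j⇒i≤pred[j] (ℤP.≤∧≢⇒< v≤1+n v≢1+n)

∑ : ℕ → (ℤ → ℤ) → ℤ
∑ ℕ.zero      f = + 0
∑ (ℕ.suc n) f = ∑ n f + f (+ ℕ.suc n)

∑-cong : ∀ n {f g} → (∀ {v} → Face n v → f v ≡ g v) → ∑ n f ≡ ∑ n g
∑-cong ℕ.zero      f≗g = refl
∑-cong (ℕ.suc n) f≗g = cong₂ _+_ (∑-cong n (λ v∈ → f≗g (face-weaken v∈))) (f≗g (top-face n))

∑-+ : ∀ n f g → ∑ n (λ v → f v + g v) ≡ ∑ n f + ∑ n g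
∑-+ ℕ.zero      f g = refl
∑-+ (ℕ.suc n) f g =
  trans (cong (_+ (f (+ ℕ.suc n) + g (+ ℕ.suc n))) (∑-+ n f g))
        (interchange (∑ n f) (∑ n g) (f (+ ℕ.suc n)) (g (+ ℕ.suc n)))

∑-- : ∀ n f g → ∑ n (λ v → f v - g v) ≡ ∑ n f - ∑ n g
∑-- ℕ.zero      f g = refl
∑-- (ℕ.suc n) f g = trans (cong (_+ (f (+ ℕ.suc n) - g (+ ℕ.suc n))) (∑-- n f g))
                          (regroup (∑ n f) (∑ n g) _ _)
  where
  regroup : ∀ p q r t → (p - q) + (r - t) ≡ (p + r) - (q + t)
  regroup = solve-∀

∑-neg : ∀ n f → ∑ n (λ v → - f v) ≡ - ∑ n f
∑-neg ℕ.zero      f = refl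
∑-neg (ℕ.suc n) f = trans (cong (_+ (- f (+ ℕ.suc n))) (∑-neg n f))
                          (sym (ℤP.neg-distrib-+ (∑ n f) _))

∑-const : ∀ n K → ∑ n (λ _ → K) ≡ + n * K
∑-const ℕ.zero      K = refl
∑-const (ℕ.suc n) K = trans (cong (_+ K) (∑-const n K)) (one-more (+ n) K)
  where
  one-more : ∀ N K → N * K + K ≡ (+ 1 + N) * K
  one-more = solve-∀

∑-zero : ∀ n → ∑ n (λ _ → + 0) ≡ + 0
∑-zero n = trans (∑-const n (+ 0)) (ℤP.*-zeroʳ (+ n))

∑-swap : ∀ n m (h : ℤ → ℤ → ℤ) →
  ∑ n (λ v → ∑ m (λ w → h v w)) ≡ ∑ m (λ w → ∑ n (λ v → h v w))
∑-swap ℕ.zero      m h = sym (∑-zero m)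
∑-swap (ℕ.suc n) m h = trans (cong (_+ ∑ m (h (+ ℕ.suc n))) (∑-swap n m h))
                             (sym (∑-+ m (λ w → ∑ n (λ v → h v w)) (h (+ ℕ.suc n))))

∑-front : ∀ n f → ∑ (ℕ.suc n) f ≡ f (+ 1) + ∑ n (λ v → f (+ 1 + v))
∑-front ℕ.zero      f = ℤP.+-comm (+ 0) (f (+ 1))
∑-front (ℕ.suc n) f = trans (cong (_+ f (+ ℕ.suc (ℕ.suc n))) (∑-front n f))
                            (ℤP.+-assoc (f (+ 1)) _ _)

∑-double : ∀ n → ∑ n (λ v → v + v) ≡ + n * (+ 1 + + n)
∑-double ℕ.zero      = refl
∑-double (ℕ.suc n) = trans (cong (_+ (+ ℕ.suc n + + ℕ.suc n)) (∑-double n)) (next (+ n))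
  where
  next : ∀ N → N * (+ 1 + N) + ((+ 1 + N) + (+ 1 + N)) ≡ (+ 1 + N) * (+ 1 + (+ 1 + N))
  next = solve-∀

δ-refl : ∀ x → δ x x ≡ + 1
δ-refl x rewrite dec-true (x ≟ x) refl = refl

δ-ne : ∀ {x y} → x ≢ y → δ x y ≡ + 0
δ-ne {x} {y} x≢y rewrite dec-false (x ≟ y) x≢y = refl

δ-nonneg : ∀ x y → + 0 ≤ δ x y
δ-nonneg x y with does (x ≟ y)
... | true  = +≤+ ℕ.z≤n
... | false = +≤+ ℕ.z≤n

+1-1 : ∀ x → (x + + 1) - + 1 ≡ x
+1-1 = solve-∀

-1+1 : ∀ x → (x - + 1) + + 1 ≡ x
-1+1 = solve-∀

+1-injective : ∀ {x y} → x + + 1 ≡ y + + 1 → x ≡ y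
+1-injective {x} {y} eq = trans (sym (+1-1 x)) (trans (cong (_- + 1) eq) (+1-1 y))

δ-shift : ∀ x y → δ (x + + 1) (y + + 1) ≡ δ x y
δ-shift x y with x ≟ y
... | yes refl = δ-refl (x + + 1)
... | no x≢y   = δ-ne (λ eq → x≢y (+1-injective eq))

∑-δ : ∀ n {k} K → Face n k → ∑ n (λ v → δ v k * K) ≡ K
∑-δ ℕ.zero      K k∈ = ⊥-elim (no-face-zero k∈)
∑-δ (ℕ.suc n) {k} K k∈ with k ≟ + ℕ.suc n
... | yes refl = begin
  ∑ n (λ v → δ v k * K) + δ k k * K  ≡⟨ cong₂ _+_ (∑-cong n off-k) (cong (_* K) (δ-refl k)) ⟩
  ∑ n (λ _ → + 0) + + 1 * K           ≡⟨ cong₂ _+_ (∑-zero n) (ℤP.*-identityˡ K) ⟩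
  + 0 + K                              ≡⟨ ℤP.+-identityˡ K ⟩
  K                                    ∎
  where
  off-k : ∀ {v} → Face n v → δ v k * K ≡ + 0
  off-k v∈ = trans (cong (_* K) (δ-ne (ℤP.<⇒≢ (face-<-top v∈)))) (ℤP.*-zeroˡ K)
... | no k≢top = begin
  ∑ n (λ v → δ v k * K) + δ (+ ℕ.suc n) k * K  ≡⟨ cong₂ _+_ (∑-δ n K (face-below-top k∈ k≢top))
                                                            (cong (_* K) (δ-ne (λ eq → k≢top (sym eq)))) ⟩
  K + + 0 * K                                   ≡⟨ cong (λ t → K + t) (ℤP.*-zeroˡ K) ⟩
  K + + 0                                       ≡⟨ ℤP.+-identityʳ K ⟩
  K                                             ∎

step : ℤ → ℤ → ℤ → ℤ
step a b v = (v + δ v a) - δ v b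

step-at-a : ∀ {a b} → a ≢ b → step a b a ≡ a + + 1
step-at-a {a} {b} a≢b rewrite δ-refl a | δ-ne a≢b = ℤP.+-identityʳ (a + + 1)

step-at-b : ∀ {a b} → a ≢ b → step a b b ≡ b - + 1
step-at-b {a} {b} a≢b rewrite δ-refl b | δ-ne (λ eq → a≢b (sym eq)) = cong (_- + 1) (ℤP.+-identityʳ b)

step-elsewhere : ∀ {a b v} → v ≢ a → v ≢ b → step a b v ≡ v
step-elsewhere {a} {b} {v} v≢a v≢b rewrite δ-ne v≢a | δ-ne v≢b =
  trans (ℤP.+-identityʳ (v + + 0)) (ℤP.+-identityʳ v)

step-pointwise : ∀ (H : ℤ → ℤ) {a b} → a ≢ b → ∀ v →
  H (step a b v) ≡ H v + (δ v a * (H (a + + 1) - H a) + δ v b * (H (b - + 1) - H b))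
step-pointwise H {a} {b} a≢b v = by-cases a≢b v (v ≟ a) (v ≟ b)
  where
  by-cases : ∀ {a b} → a ≢ b → ∀ v → Dec (v ≡ a) → Dec (v ≡ b) →
    H (step a b v) ≡ H v + (δ v a * (H (a + + 1) - H a) + δ v b * (H (b - + 1) - H b))
  by-cases {b = b} a≢b v (yes refl) _ rewrite step-at-a a≢b | δ-refl v | δ-ne a≢b =
    only-first (H v) (H (v + + 1)) (H (b - + 1) - H b)
    where
    only-first : ∀ p q r → q ≡ p + (+ 1 * (q - p) + + 0 * r)
    only-first = solve-∀
  by-cases {a = a} a≢b v (no v≢a) (yes refl) rewrite step-at-b a≢b | δ-refl v | δ-ne v≢a =
    only-second (H v) (H (v - + 1)) (H (a + + 1) - H a)
    where
    only-second : ∀ p q r → q ≡ p + (+ 0 * r + + 1 * (q - p))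
    only-second = solve-∀
  by-cases {a} {b} a≢b v (no v≢a) (no v≢b) rewrite step-elsewhere v≢a v≢b | δ-ne v≢a | δ-ne v≢b =
    neither (H v) (H (a + + 1) - H a) (H (b - + 1) - H b)
    where
    neither : ∀ p q r → p ≡ p + (+ 0 * q + + 0 * r)
    neither = solve-∀

∑-step : ∀ n (H : ℤ → ℤ) {a b} → a ≢ b → Face n a → Face n b →
  ∑ n (λ v → H (step a b v)) ≡ ∑ n H + ((H (a + + 1) - H a) + (H (b - + 1) - H b))
∑-step n H {a} {b} a≢b a∈ b∈ = begin
  ∑ n (λ v → H (step a b v))
    ≡⟨ ∑-cong n (λ {v} _ → step-pointwise H a≢b v) ⟩
  ∑ n (λ v → H v + (δ v a * Δa + δ v b * Δb))
    ≡⟨ ∑-+ n H _ ⟩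
  ∑ n H + ∑ n (λ v → δ v a * Δa + δ v b * Δb)
    ≡⟨ cong (λ t → ∑ n H + t) (∑-+ n (λ v → δ v a * Δa) (λ v → δ v b * Δb)) ⟩
  ∑ n H + (∑ n (λ v → δ v a * Δa) + ∑ n (λ v → δ v b * Δb))
    ≡⟨ cong (λ t → ∑ n H + t) (cong₂ _+_ (∑-δ n Δa a∈) (∑-δ n Δb b∈)) ⟩
  ∑ n H + (Δa + Δb)  ∎
  where
  Δa = H (a + + 1) - H a
  Δb = H (b - + 1) - H b

less : ℤ → ℤ → ℤ
less y x = if does (y <? x) then + 1 else + 0

sgn : ℤ → ℤ → ℤ
sgn x y = less y x - less x y

less-yes : ∀ {y x} → y < x → less y x ≡ + 1
less-yes {y} {x} y<x rewrite dec-true (y <? x) y<x = refl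

less-no : ∀ {y x} → ¬ (y < x) → less y x ≡ + 0
less-no {y} {x} y≮x rewrite dec-false (y <? x) y≮x = refl

sgn-pos : ∀ {x y} → y < x → sgn x y ≡ + 1
sgn-pos y<x rewrite less-yes y<x | less-no (ℤP.<-asym y<x) = refl

sgn-neg : ∀ {x y} → x < y → sgn x y ≡ - + 1
sgn-neg x<y rewrite less-yes x<y | less-no (ℤP.<-asym x<y) = refl

sgn-self : ∀ x → sgn x x ≡ + 0
sgn-self x rewrite less-no (ℤP.<-irrefl {x} refl) = refl

swap-difference : ∀ p q → p - q ≡ - (q - p)
swap-difference = solve-∀

sgn-anti : ∀ x y → sgn x y ≡ - sgn y x
sgn-anti x y = swap-difference (less y x) (less x y)

<-+1 : ∀ y → y < y + + 1
<-+1 y = ℤP.suc[i]≤j⇒i<j (ℤP.≤-reflexive (ℤP.+-comm (+ 1) y))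

+1-<-above : ∀ {x y} → y < x → x ≢ y + + 1 → y + + 1 < x
+1-<-above {x} {y} y<x x≢y+1 =
  ℤP.≤∧≢⇒< (subst (_≤ x) (ℤP.+-comm (+ 1) y) (ℤP.i<j⇒suc[i]≤j y<x)) (λ eq → x≢y+1 (sym eq))

sgn-step : ∀ x y → sgn x (y + + 1) - sgn x y ≡ - (δ x y + δ x (y + + 1))
sgn-step x y = by-cases x y (ℤP.<-cmp x y) (x ≟ y + + 1)
  where
  by-cases : ∀ x y → Tri (x < y) (x ≡ y) (y < x) → Dec (x ≡ y + + 1) →
    sgn x (y + + 1) - sgn x y ≡ - (δ x y + δ x (y + + 1))
  by-cases x y (tri< x<y _ _) _
    rewrite sgn-neg x<y | sgn-neg (ℤP.<-trans x<y (<-+1 y))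
          | δ-ne (ℤP.<⇒≢ x<y) | δ-ne (ℤP.<⇒≢ (ℤP.<-trans x<y (<-+1 y))) = refl
  by-cases x .x (tri≈ _ refl _) _
    rewrite sgn-neg (<-+1 x) | sgn-self x | δ-refl x | δ-ne (ℤP.<⇒≢ (<-+1 x)) = refl
  by-cases .(y + + 1) y (tri> _ _ y<x) (yes refl)
    rewrite sgn-self (y + + 1) | sgn-pos (<-+1 y)
          | δ-ne (λ eq → ℤP.<⇒≢ (<-+1 y) (sym eq)) | δ-refl (y + + 1) = refl
  by-cases x y (tri> _ _ y<x) (no x≢y+1)
    rewrite sgn-pos (+1-<-above y<x x≢y+1) | sgn-pos y<x
          | δ-ne (λ eq → ℤP.<⇒≢ y<x (sym eq)) | δ-ne x≢y+1 = refl

sgn-step-down : ∀ x y → sgn x (y - + 1) - sgn x y ≡ δ x (y - + 1) + δ x y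
sgn-step-down x y = begin
  sgn x z - sgn x y                 ≡⟨ cong (λ t → sgn x z - sgn x t) (sym (-1+1 y)) ⟩
  sgn x z - sgn x (z + + 1)         ≡⟨ swap-difference (sgn x z) (sgn x (z + + 1)) ⟩
  - (sgn x (z + + 1) - sgn x z)     ≡⟨ cong -_ (sgn-step x z) ⟩
  - - (δ x z + δ x (z + + 1))       ≡⟨ ℤP.neg-involutive _ ⟩
  δ x z + δ x (z + + 1)             ≡⟨ cong (λ t → δ x z + δ x t) (-1+1 y) ⟩
  δ x z + δ x y                     ∎
  where
  z = y - + 1

-- Against the standard n-sided die a face m wins m-1 times and loses n-m times.
∑-sgn-row : ∀ n {m} → Face n m → ∑ n (sgn m) ≡ (m + m) - (+ 1 + + n)
∑-sgn-row ℕ.zero      m∈ = ⊥-elim (no-face-zero m∈)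
∑-sgn-row (ℕ.suc n) {m} m∈ with m ≟ + ℕ.suc n
... | yes refl = begin
  ∑ n (sgn m) + sgn m m        ≡⟨ cong₂ _+_ (∑-cong n (λ v∈ → sgn-pos (face-<-top v∈))) (sgn-self m) ⟩
  ∑ n (λ _ → + 1) + + 0        ≡⟨ cong (_+ + 0) (∑-const n (+ 1)) ⟩
  + n * + 1 + + 0              ≡⟨ top (+ n) ⟩
  (m + m) - (+ 1 + m)          ∎
  where
  top : ∀ N → N * + 1 + + 0 ≡ ((+ 1 + N) + (+ 1 + N)) - (+ 1 + (+ 1 + N))
  top = solve-∀
... | no m≢top = begin
  ∑ n (sgn m) + sgn m (+ ℕ.suc n)     ≡⟨ cong₂ _+_ (∑-sgn-row n m∈ₙ) (sgn-neg (face-<-top m∈ₙ)) ⟩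
  ((m + m) - (+ 1 + + n)) + - + 1     ≡⟨ below (m + m) (+ n) ⟩
  (m + m) - (+ 1 + + ℕ.suc n)         ∎
  where
  m∈ₙ : Face n m
  m∈ₙ = face-below-top m∈ m≢top
  below : ∀ M N → (M - (+ 1 + N)) + - + 1 ≡ M - (+ 1 + (+ 1 + N))
  below = solve-∀

∑-sgn-column : ∀ n {m} → Face n m → ∑ n (λ v → sgn v m) ≡ - ((m + m) - (+ 1 + + n))
∑-sgn-column n {m} m∈ = begin
  ∑ n (λ v → sgn v m)     ≡⟨ ∑-cong n (λ {v} _ → sgn-anti v m) ⟩
  ∑ n (λ v → - sgn m v)   ≡⟨ ∑-neg n (sgn m) ⟩
  - ∑ n (sgn m)           ≡⟨ cong -_ (∑-sgn-row n m∈) ⟩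
  - ((m + m) - (+ 1 + + n)) ∎

∑-sgn-total : ∀ n → ∑ n (λ v → ∑ n (sgn v)) ≡ + 0
∑-sgn-total n = begin
  ∑ n (λ v → ∑ n (sgn v))                    ≡⟨ ∑-cong n (∑-sgn-row n) ⟩
  ∑ n (λ v → (v + v) - N)                    ≡⟨ ∑-- n (λ v → v + v) (λ _ → N) ⟩
  ∑ n (λ v → v + v) - ∑ n (λ _ → N)          ≡⟨ cong₂ _-_ (∑-double n) (∑-const n N) ⟩
  + n * N - + n * N                          ≡⟨ ℤP.+-inverseʳ (+ n * N) ⟩
  + 0                                        ∎
  where
  N = + 1 + + n

vsum : ∀ {m} → Vec ℤ m → (ℤ → ℤ) → ℤ
vsum []       h = + 0
vsum (x ∷ xs) h = h x + vsum xs h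

vsum-cong : ∀ {m} (A : Vec ℤ m) {h h′} → (∀ x → h x ≡ h′ x) → vsum A h ≡ vsum A h′
vsum-cong []      h≗h′ = refl
vsum-cong (x ∷ A) h≗h′ = cong₂ _+_ (h≗h′ x) (vsum-cong A h≗h′)

vsum-tabulate : ∀ n (f : ℤ → ℤ) h →
  vsum (tabulate {n = n} (λ i → f (+ ℕ.suc (toℕ i)))) h ≡ ∑ n (λ v → h (f v))
vsum-tabulate ℕ.zero      f h = refl
vsum-tabulate (ℕ.suc n) f h =
  trans (cong (λ t → h (f (+ 1)) + t) (vsum-tabulate n (λ v → f (+ 1 + v)) h))
        (sym (∑-front n (λ v → h (f v))))

below-count : ∀ {m} x acc (B : Vec ℤ m) →
  + foldr (λ _ → ℕ) (λ y acc′ → (if does (y <? x) then 1 else 0) ℕ.+ acc′) acc B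
    ≡ vsum B (λ y → less y x) + + acc
below-count x acc []      = refl
below-count x acc (y ∷ B) =
  trans (one-more (does (y <? x)) _)
        (trans (cong (λ t → less y x + t) (below-count x acc B)) (sym (ℤP.+-assoc (less y x) _ _)))
  where
  one-more : ∀ (b : Bool) r → + ((if b then 1 else 0) ℕ.+ r) ≡ (if b then + 1 else + 0) + + r
  one-more true  r = refl
  one-more false r = refl

wins-vsum : ∀ {n m} (A : Vec ℤ n) (B : Vec ℤ m) → + wins A B ≡ vsum A (λ x → vsum B (λ y → less y x))
wins-vsum []      B = refl
wins-vsum (x ∷ A) B =
  trans (below-count x (wins A B) B) (cong (λ t → vsum B (λ y → less y x) + t) (wins-vsum A B))

wins-s : ∀ n a b c d →
  + wins (s n a b) (s n c d) ≡ ∑ n (λ v → ∑ n (λ w → less (step c d w) (step a b v)))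
wins-s n a b c d = begin
  + wins (s n a b) (s n c d)
    ≡⟨ wins-vsum (s n a b) (s n c d) ⟩
  vsum (s n a b) (λ x → vsum (s n c d) (λ y → less y x))
    ≡⟨ vsum-cong (s n a b) (λ x → vsum-tabulate n (step c d) (λ y → less y x)) ⟩
  vsum (s n a b) (λ x → ∑ n (λ w → less (step c d w) x))
    ≡⟨ vsum-tabulate n (step a b) (λ x → ∑ n (λ w → less (step c d w) x)) ⟩
  ∑ n (λ v → ∑ n (λ w → less (step c d w) (step a b v)))  ∎

advantage : ∀ {n} → Tuple n → Tuple n → ℤ
advantage A B = + wins A B - + wins B A

advantage-sgn : ∀ n a b c d →
  advantage (s n a b) (s n c d) ≡ ∑ n (λ v → ∑ n (λ w → sgn (step a b v) (step c d w)))
advantage-sgn n a b c d = begin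
  + wins (s n a b) (s n c d) - + wins (s n c d) (s n a b)
    ≡⟨ cong₂ _-_ (wins-s n a b c d) (trans (wins-s n c d a b) (∑-swap n n (λ w v → less (A v) (B w)))) ⟩
  ∑ n (λ v → ∑ n (λ w → less (B w) (A v))) - ∑ n (λ v → ∑ n (λ w → less (A v) (B w)))
    ≡⟨ sym (∑-- n _ _) ⟩
  ∑ n (λ v → ∑ n (λ w → less (B w) (A v)) - ∑ n (λ w → less (A v) (B w)))
    ≡⟨ ∑-cong n (λ _ → sym (∑-- n _ _)) ⟩
  ∑ n (λ v → ∑ n (λ w → sgn (A v) (B w)))  ∎
  where
  A = step a b
  B = step c d

record OneStep (n : ℕ) (a b : ℤ) : Set where
  field
    distinct : a ≢ b
    face-a   : Face n a
    face-a+1 : Face n (a + + 1)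
    face-b   : Face n b
    face-b-1 : Face n (b - + 1)

module Against (n : ℕ) (c d : ℤ) where

  score : ℤ → ℤ
  score x = ∑ n (λ w → sgn x (step c d w))

  bump : ℤ → ℤ
  bump x = (sgn x (c + + 1) - sgn x c) + (sgn x (d - + 1) - sgn x d)

  score-bump : OneStep n c d → ∀ x → score x ≡ ∑ n (sgn x) + bump x
  score-bump cd x = ∑-step n (sgn x) distinct face-c face-d
    where open OneStep cd renaming (face-a to face-c; face-b to face-d)

  score-face : OneStep n c d → ∀ {m} → Face n m → score m ≡ ((m + m) - (+ 1 + + n)) + bump m
  score-face cd {m} m∈ = trans (score-bump cd m) (cong (_+ bump m) (∑-sgn-row n m∈))

  ∑-bump : OneStep n c d → ∑ n bump ≡ + 0
  ∑-bump cd = begin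
    ∑ n bump
      ≡⟨ ∑-+ n (λ x → sgn x (c + + 1) - sgn x c) (λ x → sgn x (d - + 1) - sgn x d) ⟩
    ∑ n (λ x → sgn x (c + + 1) - sgn x c) + ∑ n (λ x → sgn x (d - + 1) - sgn x d)
      ≡⟨ cong₂ _+_ (∑-- n (λ x → sgn x (c + + 1)) (λ x → sgn x c))
                   (∑-- n (λ x → sgn x (d - + 1)) (λ x → sgn x d)) ⟩
    (column (c + + 1) - column c) + (column (d - + 1) - column d)
      ≡⟨ cong₂ _+_ (cong₂ _-_ (∑-sgn-column n face-c+1) (∑-sgn-column n face-c))
                   (cong₂ _-_ (∑-sgn-column n face-d-1) (∑-sgn-column n face-d)) ⟩
    (- row (c + + 1) - - row c) + (- row (d - + 1) - - row d)
      ≡⟨ telescope c d (+ 1 + + n) ⟩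
    + 0  ∎
    where
    open OneStep cd renaming (face-a to face-c; face-a+1 to face-c+1; face-b to face-d; face-b-1 to face-d-1)
    column : ℤ → ℤ
    column m = ∑ n (λ x → sgn x m)
    row : ℤ → ℤ
    row m = (m + m) - (+ 1 + + n)
    telescope : ∀ C D N → (- (((C + + 1) + (C + + 1)) - N) - - ((C + C) - N))
                        + (- (((D - + 1) + (D - + 1)) - N) - - ((D + D) - N)) ≡ + 0
    telescope = solve-∀

  ∑-score : OneStep n c d → ∑ n score ≡ + 0
  ∑-score cd = begin
    ∑ n score                                ≡⟨ ∑-cong n (λ {x} _ → score-bump cd x) ⟩
    ∑ n (λ x → ∑ n (sgn x) + bump x)         ≡⟨ ∑-+ n (λ x → ∑ n (sgn x)) bump ⟩
    ∑ n (λ x → ∑ n (sgn x)) + ∑ n bump       ≡⟨ cong₂ _+_ (∑-sgn-total n) (∑-bump cd) ⟩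
    + 0                                      ∎

  bump-δ : ∀ x → bump x ≡ - (δ x c + δ x (c + + 1)) + (δ x (d - + 1) + δ x d)
  bump-δ x = cong₂ _+_ (sgn-step x c) (sgn-step-down x d)

  bump-step : ∀ x → bump (x + + 1) - bump x
                    ≡ (δ x (c + + 1) + δ (x + + 1) (d - + 1)) - (δ (x + + 1) c + δ x d)
  bump-step x = begin
    bump (x + + 1) - bump x
      ≡⟨ cong₂ _-_ (bump-δ (x + + 1)) (bump-δ x) ⟩
    (- (δ x′ c + δ x′ (c + + 1)) + (δ x′ (d - + 1) + δ x′ d))
      - (- (δ x c + δ x (c + + 1)) + (δ x (d - + 1) + δ x d))
      ≡⟨ cong₂ (λ p q → (- (δ x′ c + p) + (δ x′ (d - + 1) + q))
                        - (- (δ x c + δ x (c + + 1)) + (δ x (d - + 1) + δ x d)))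
               (δ-shift x c)
               (trans (cong (δ x′) (sym (-1+1 d))) (δ-shift x (d - + 1))) ⟩
    (- (δ x′ c + δ x c) + (δ x′ (d - + 1) + δ x (d - + 1)))
      - (- (δ x c + δ x (c + + 1)) + (δ x (d - + 1) + δ x d))
      ≡⟨ cancel (δ x′ c) (δ x c) (δ x′ (d - + 1)) (δ x (d - + 1)) (δ x (c + + 1)) (δ x d) ⟩
    (δ x (c + + 1) + δ x′ (d - + 1)) - (δ x′ c + δ x d)  ∎
    where
    x′ = x + + 1
    cancel : ∀ p q r t u v → (- (p + q) + (r + t)) - (- (q + u) + (t + v)) ≡ (u + r) - (p + v)
    cancel = solve-∀

  bump-step-down : ∀ b → bump b - bump (b - + 1)
                    ≡ (δ (b - + 1) (c + + 1) + δ b (d - + 1)) - (δ b c + δ (b - + 1) d)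
  bump-step-down b =
    subst (λ t → bump t - bump (b - + 1) ≡ (δ (b - + 1) (c + + 1) + δ t (d - + 1)) - (δ t c + δ (b - + 1) d))
          (-1+1 b) (bump-step (b - + 1))

gains : ℤ → ℤ → ℤ → ℤ → ℤ
gains a b c d = ((δ a (c + + 1) + δ (a + + 1) (d - + 1)) + δ b c) + δ (b - + 1) d

losses : ℤ → ℤ → ℤ → ℤ → ℤ
losses a b c d = ((δ (a + + 1) c + δ a d) + δ (b - + 1) (c + + 1)) + δ b (d - + 1)

advantage-formula : ∀ {n a b c d} → OneStep n a b → OneStep n c d →
  advantage (s n a b) (s n c d) ≡ gains a b c d - losses a b c d
advantage-formula {n} {a} {b} {c} {d} ab cd = begin
  advantage (s n a b) (s n c d)
    ≡⟨ advantage-sgn n a b c d ⟩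
  ∑ n (λ v → score (step a b v))
    ≡⟨ ∑-step n score distinct face-a face-b ⟩
  ∑ n score + ((score (a + + 1) - score a) + (score (b - + 1) - score b))
    ≡⟨ cong₂ _+_ (∑-score cd) (cong₂ _+_ (cong₂ _-_ (score-face cd face-a+1) (score-face cd face-a))
                                         (cong₂ _-_ (score-face cd face-b-1) (score-face cd face-b))) ⟩
  + 0 + (((row (a + + 1) + bump (a + + 1)) - (row a + bump a))
       + ((row (b - + 1) + bump (b - + 1)) - (row b + bump b)))
    ≡⟨ rows-cancel a b (bump (a + + 1)) (bump a) (bump (b - + 1)) (bump b) (+ 1 + + n) ⟩
  (bump (a + + 1) - bump a) - (bump b - bump (b - + 1))
    ≡⟨ cong₂ _-_ (bump-step a) (bump-step-down b) ⟩
  ((δ a (c + + 1) + δ (a + + 1) (d - + 1)) - (δ (a + + 1) c + δ a d))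
    - ((δ (b - + 1) (c + + 1) + δ b (d - + 1)) - (δ b c + δ (b - + 1) d))
    ≡⟨ regroup (δ a (c + + 1)) (δ (a + + 1) (d - + 1)) (δ (a + + 1) c) (δ a d)
               (δ (b - + 1) (c + + 1)) (δ b (d - + 1)) (δ b c) (δ (b - + 1) d) ⟩
  gains a b c d - losses a b c d  ∎
  where
  open Against n c d
  open OneStep ab
  row : ℤ → ℤ
  row m = (m + m) - (+ 1 + + n)
  rows-cancel : ∀ A B P Q R T N →
    + 0 + (((((A + + 1) + (A + + 1)) - N + P) - ((A + A) - N + Q))
         + ((((B - + 1) + (B - + 1)) - N + R) - ((B + B) - N + T)))
    ≡ (P - Q) - (T - R)
  rows-cancel = solve-∀
  regroup : ∀ p q r t u v w z → ((p + q) - (r + t)) - ((u + v) - (w + z))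
                                ≡ (((p + q) + w) + z) - (((r + t) + u) + v)
  regroup = solve-∀

entry-of-face : ∀ {n} a b {v} → Face n v → ∃[ i ] lookup (s n a b) i ≡ step a b v
entry-of-face {n} a b (+≤+ {n = ℕ.suc k} _ , v≤n) =
  fromℕ< k<n , trans (lookup∘tabulate (λ i → step a b (+ ℕ.suc (toℕ i))) (fromℕ< k<n))
                     (cong (λ j → step a b (+ ℕ.suc j)) (toℕ-fromℕ< k<n))
  where
  k<n = ℤP.drop‿+≤+ v≤n

proper⇒OneStep : ∀ {n a b} → a ≢ b → Face n a → Face n b → Proper (s n a b) → OneStep n a b
proper⇒OneStep {n} {a} {b} a≢b a∈@(1≤a , _) b∈@(_ , b≤n) (_ , entries-in-range , _) = record
  { distinct = a≢b
  ; face-a   = a∈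
  ; face-a+1 = ℤP.≤-trans 1≤a (ℤP.i≤i+j a (+ 1)) , subst (_≤ + n) (step-at-a a≢b) entry-a≤n
  ; face-b   = b∈
  ; face-b-1 = subst (+ 1 ≤_) (step-at-b a≢b) 1≤entry-b , ℤP.≤-trans (ℤP.i-j≤i b (+ 1)) b≤n
  }
  where
  entry-a≤n : step a b a ≤ + n
  entry-a≤n with entry-of-face a b a∈
  ... | i , eq = subst (_≤ + n) eq (proj₂ (entries-in-range i))
  1≤entry-b : + 1 ≤ step a b b
  1≤entry-b with entry-of-face a b b∈
  ... | i , eq = subst (+ 1 ≤_) eq (proj₁ (entries-in-range i))

no-gains : ∀ {a b c d} → a ≢ c + + 1 → d ≢ a + + 2 → b ≢ c → b ≢ d + + 1 → gains a b c d ≡ + 0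
no-gains {a} {b} {c} {d} a≢c+1 d≢a+2 b≢c b≢d+1 =
  cong₂ _+_ (cong₂ _+_ (cong₂ _+_ (δ-ne a≢c+1) (δ-ne a+1≢d-1)) (δ-ne b≢c)) (δ-ne b-1≢d)
  where
  a+1≢d-1 : a + + 1 ≢ d - + 1
  a+1≢d-1 eq = d≢a+2 (trans (sym (-1+1 d)) (trans (cong (_+ + 1) (sym eq)) (plus-two a)))
    where
    plus-two : ∀ x → (x + + 1) + + 1 ≡ x + + 2
    plus-two = solve-∀
  b-1≢d : b - + 1 ≢ d
  b-1≢d eq = b≢d+1 (trans (sym (-1+1 b)) (cong (_+ + 1) eq))

cannot-beat : ∀ {n a b c d} → OneStep n a b → OneStep n c d → gains a b c d ≡ + 0 →
  ¬ (s n a b beats s n c d)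
cannot-beat {n} {a} {b} {c} {d} ab cd no-gain ab-beats-cd =
  ℕP.<⇒≱ ab-beats-cd (ℤP.drop‿+≤+ (ℤP.i-j≤0⇒i≤j advantage≤0))
  where
  losses≥0 : + 0 ≤ losses a b c d
  losses≥0 = ℤP.+-mono-≤ (ℤP.+-mono-≤ (ℤP.+-mono-≤ (δ-nonneg (a + + 1) c) (δ-nonneg a d))
                                  (δ-nonneg (b - + 1) (c + + 1)))
                         (δ-nonneg b (d - + 1))
  advantage≤0 : advantage (s n a b) (s n c d) ≤ + 0
  advantage≤0 = ℤP.≤-trans (ℤP.≤-reflexive no-losses) (ℤP.neg-mono-≤ losses≥0)
    where
    no-losses : advantage (s n a b) (s n c d) ≡ - losses a b c d
    no-losses = begin
      advantage (s n a b) (s n c d)  ≡⟨ advantage-formula ab cd ⟩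
      gains a b c d - losses a b c d ≡⟨ cong (_- losses a b c d) no-gain ⟩
      + 0 - losses a b c d           ≡⟨ ℤP.+-identityˡ (- losses a b c d) ⟩
      - losses a b c d               ∎

mainTheorem1 : (n : ℕ) → 3 Data.Nat.≤ n → (a b c d : ℤ)
    → + 1 ≤ a → a ≤ + n → + 1 ≤ b → b ≤ + n → a ≢ b
    → + 1 ≤ c → c ≤ + n → + 1 ≤ d → d ≤ + n → c ≢ d
    → Proper (s n a b) → Proper (s n c d) → s n a b beats s n c d
    → ∃[ x ] ∃[ y ] ∃[ z ]
        ((s n a b ≡ s n x y × s n c d ≡ s n y z)
        ⊎ (s n a b ≡ s n x y × s n c d ≡ s n z (x + + 2))
        ⊎ (s n a b ≡ s n (x + + 1) y × s n c d ≡ s n x z)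
        ⊎ (s n a b ≡ s n x (y + + 1) × s n c d ≡ s n z y))
mainTheorem1 n _ a b c d 1≤a a≤n 1≤b b≤n a≢b 1≤c c≤n 1≤d d≤n c≢d proper-ab proper-cd ab-beats-cd
  with b ≟ c | d ≟ a + + 2 | a ≟ c + + 1 | b ≟ d + + 1
... | yes b≡c | _ | _ | _ = a , b , d , inj₁ (refl , cong (λ t → s n t d) (sym b≡c))
... | no _ | yes d≡a+2 | _ | _ = a , b , c , inj₂ (inj₁ (refl , cong (s n c) d≡a+2))
... | no _ | no _ | yes a≡c+1 | _ = c , b , d , inj₂ (inj₂ (inj₁ (cong (λ t → s n t b) a≡c+1 , refl)))
... | no _ | no _ | no _ | yes b≡d+1 = a , d , c , inj₂ (inj₂ (inj₂ (cong (s n a) b≡d+1 , refl)))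
... | no b≢c | no d≢a+2 | no a≢c+1 | no b≢d+1 =
  ⊥-elim (cannot-beat ab cd (no-gains a≢c+1 d≢a+2 b≢c b≢d+1) ab-beats-cd)
  where
  ab : OneStep n a b
  ab = proper⇒OneStep a≢b (1≤a , a≤n) (1≤b , b≤n) proper-ab
  cd : OneStep n c d
  cd = proper⇒OneStep c≢d (1≤c , c≤n) (1≤d , d≤n) proper-cd
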